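{- Let $N=(P,T,F)$ be a safe and sound WF-net and let $G=\{T_1,\dots,T_n\}$ be such that $(N,G)$ is an XOR pattern. For each $k\in\{1,\dots,n\}$, let $N_k=\mathrm{xorproject}(N,T_k)$. Then each $N_k$ is a safe and sound WF-net.
   Context: A Petri net is a triple $N=(P,T,F)$ with finite disjoint sets $P$ (places) and $T$ (transitions) and flow relation $F\subseteq(P\times T)\cup(T\times P)$; transitions carry labels in $\mathcal{A}\cup\{\tau\}$ ($\tau$ silent). For a node $x$, ${}^\bullet x=\{y\mid (y,x)\in F\}$ and $x^\bullet=\{y\mid (x,y)\in F\}$. A marking is a multiset of places; $t$ is enabled if every place of ${}^\bullet t$ holds a token, and firing it removes one token from each place of ${}^\bullet t$ and adds one to each place of $t^\bullet$. $N$ is a WF-net if there are places $i_N$, $o_N$ with $\{p\mid {}^\bullet p=\emptyset\}=\{i_N\}$, $\{p\mid p^\bullet=\emptyset\}=\{o_N\}$, and every node lies on a directed path from $i_N$ to $o_N$. A WF-net is safe if no marking reachable from $[i_N]$ has a place with more than one token; it is sound if (i) every transition is enabled in some marking reachable from $[i_N]$, (ii) from every marking reachable from $[i_N]$ the marking $[o_N]$ is reachable, and (iii) $[o_N]$ is the only reachable marking with a token in $o_N$. For $T'\subseteq T$, $P|_{T'}=\{p\in P\mid({}^\bullet p\cup p^\bullet)\cap T'\ne\emptyset\}$ and, for $P'\subseteq P$, $F|_{P',T'}=F\cap((P'\times T')\cup(T'\times P'))$. Transition reachability: $t\rightsquigarrow t'$ iff there are $n\ge1$, places $p_1,\dots,p_n$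 and transitions $t_1=t,\dots,t_{n+1}=t'$ with $(t_k,p_k)\in F$ and $(p_k,t_{k+1})\in F$ for all $k$. For a safe and sound WF-net $N$ and a partition $G$ of $T$ of size $n\ge2$ (with $G_t$ the part containing $t$), $(N,G)$ is an XOR pattern iff for all $t,t'\in T$, $t\rightsquigarrow t'$ implies $G_t=G_{t'}$. For a part $T'\in G$, $\mathrm{xorproject}(N,T')=(P|_{T'},T',F|_{P|_{T'},T'})$. -}

module Defs where

open import Level using (0ℓ)
open import Data.Nat using (ℕ; _≤_; _+_)
open import Data.Bool using (Bool; true; false; _∧_; _∨_; if_then_else_) renaming (T to IsTrue)
open import Data.Fin using (Fin; _≟_)
open import Data.List using (allFin)
open import Data.Bool.ListAction using (any)
open import Data.Maybe using (Maybe)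
open import Data.Product using (Σ; ∃; _×_; _,_; proj₁)
open import Data.Sum using (_⊎_; inj₁; inj₂)
open import Data.Empty using (⊥)
open import Relation.Nullary using (¬_)
open import Relation.Nullary.Decidable using (⌊_⌋)
open import Relation.Binary.PropositionalEquality using (_≡_; _≢_)
open import Relation.Binary.Construct.Closure.ReflexiveTransitive using (Star)
open import Relation.Binary.Construct.Closure.Transitive using (TransClosure)
open import Function.Bundles using (_↔_)

-- Places and transitions are given as two separate
-- types (hence disjoint).  The flow relation F ⊆ (P×T) ∪ (T×P) is given by
-- its two (Boolean) characteristic functions:
--   pre  p t ≡ true  iff (p , t) ∈ F
--   post t p ≡ true  iff (t , p) ∈ F
-- Labels are in A ∪ {τ}, with τ represented by 'nothing'.

record Net (A P T : Set) : Set where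
  field
    pre   : P → T → Bool
    post  : T → P → Bool
    label : T → Maybe A
open Net public

IsFinite : Set → Set
IsFinite X = Σ ℕ λ m → X ↔ Fin m

IsPetriNet : ∀ {A P T} → Net A P T → Set
IsPetriNet {A} {P} {T} N = IsFinite P × IsFinite T

Marking : Set → Set
Marking P = P → ℕ

ind : Bool → ℕ
ind b = if b then 1 else 0

module _ {A P T : Set} (N : Net A P T) where

  Enabled : Marking P → T → Set
  Enabled M t = ∀ p → pre N p t ≡ true → 1 ≤ M p

  Fires : Marking P → T → Marking P → Set
  Fires M t M' = Enabled M t × (∀ p → M' p + ind (pre N p t) ≡ M p + ind (post N t p))

  Step : Marking P → Marking P → Set
  Step M M' = ∃ λ t → Fires M t M'

  _⟶*_ : Marking P → Marking P → Set
  _⟶*_ = Star Step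

  IsSingleton : P → Marking P → Set
  IsSingleton p M = M p ≡ 1 × (∀ q → q ≢ p → M q ≡ 0)

  ReachableFrom : P → Marking P → Set
  ReachableFrom i M = ∃ λ M₀ → IsSingleton i M₀ × (M₀ ⟶* M)

  Node : Set
  Node = P ⊎ T

  Arc : Node → Node → Set
  Arc (inj₁ p) (inj₂ t) = pre N p t ≡ true
  Arc (inj₂ t) (inj₁ p) = post N t p ≡ true
  Arc _ _ = ⊥

  record IsWFNet (i o : P) : Set where
    field
      source : ∀ p → ((∀ t → post N t p ≡ false) → p ≡ i) × (p ≡ i → ∀ t → post N t p ≡ false)
      sink   : ∀ p → ((∀ t → pre N p t ≡ false) → p ≡ o) × (p ≡ o → ∀ t → pre N p t ≡ false)
      onPath : ∀ x → Star Arc (inj₁ i) x × Star Arc x (inj₁ o)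

  IsSafe : P → Set
  IsSafe i = ∀ M → ReachableFrom i M → ∀ p → M p ≤ 1

  record IsSound (i o : P) : Set where
    field
      quasiLive  : ∀ t → ∃ λ M → ReachableFrom i M × Enabled M t
      canFinish  : ∀ M → ReachableFrom i M → ∃ λ M' → (M ⟶* M') × IsSingleton o M'
      properEnd  : ∀ M → ReachableFrom i M → 1 ≤ M o → IsSingleton o M

  SafeSoundWFNet : Set
  SafeSoundWFNet = Σ P λ i → Σ P λ o → IsWFNet i o × IsSafe i × IsSound i o

  TStep : T → T → Set
  TStep t t' = ∃ λ p → post N t p ≡ true × pre N p t' ≡ true

  _⇝_ : T → T → Set
  _⇝_ = TransClosure TStep

-- Partitions of the transitions (of a net with T = Fin nt) of size n:
-- given by a surjective map g : Fin nt → Fin n; the parts are the fibres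
-- T_k = g⁻¹(k) (nonempty by surjectivity), and G_t = T_{g t}.

Surjective : ∀ {nt n} → (Fin nt → Fin n) → Set
Surjective {nt} {n} g = ∀ (k : Fin n) → ∃ λ t → g t ≡ k

IsXORPattern : ∀ {A np nt n} → Net A (Fin np) (Fin nt) → (Fin nt → Fin n) → Set
IsXORPattern {A} {np} {nt} {n} N g =
  SafeSoundWFNet N × 2 ≤ n × Surjective g × (∀ t t' → _⇝_ N t t' → g t ≡ g t')

module _ {A : Set} {np nt n : ℕ} (N : Net A (Fin np) (Fin nt)) (g : Fin nt → Fin n) (k : Fin n) where

  inPart : Fin nt → Bool
  inPart t = ⌊ g t ≟ k ⌋

  inProjPlaces : Fin np → Bool
  inProjPlaces p = any (λ t → inPart t ∧ (post N t p ∨ pre N p t)) (allFin nt)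

  ProjT : Set
  ProjT = Σ (Fin nt) λ t → IsTrue (inPart t)

  ProjP : Set
  ProjP = Σ (Fin np) λ p → IsTrue (inProjPlaces p)

  xorproject : Net A ProjP ProjT
  xorproject = record
    { pre   = λ p t → pre N (proj₁ p) (proj₁ t)
    ; post  = λ t p → post N (proj₁ t) (proj₁ p)
    ; label = λ t → label N (proj₁ t)
    }

{-# OPTIONS --safe #-}
-- Every transition has an input place, and in an XOR pattern every consumer of a place produced
-- in one part belongs to that part.  So once the first transition t of a run from [i] has fired,
-- every token sits on a place produced in the part of t, and the whole run stays in that part.
-- Runs of N inside part k and runs of the projection correspond step by step, which transfers
-- safety and soundness; the WF structure transfers because a path of N leaving (or entering) a
-- transition of T_k never leaves the part.
module Submission where

open import Defs
open import Data.Bool using (Bool; true; false; _∧_; _∨_) renaming (T to IsTrue)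
open import Data.Bool.Properties using (T-irrelevant; T-∧; T-∨; T-≡)
open import Data.Empty using (⊥-elim)
open import Data.Fin using (Fin; zero; suc; _≟_)
open import Data.Fin.Properties using (0↔⊥; 1↔⊤; +↔⊎)
open import Data.List using (allFin)
open import Data.List.Membership.Propositional using (lose)
open import Data.List.Membership.Propositional.Properties using (∈-allFin)
open import Data.List.Relation.Unary.Any using (satisfied)
open import Data.List.Relation.Unary.Any.Properties using (any⁺; any⁻)
open import Data.Nat using (ℕ; zero; suc; _≤_; _+_; _∸_; z≤n)
open import Data.Nat.Properties
  using (≤-trans; m≤m+n; +-identityʳ; +-∸-comm; m+n∸n≡m; m∸n+n≡m; <⇒≢; m<n+m; module ≤-Reasoning)
open import Data.Product using (Σ; ∃; ∃₂; _×_; _,_; proj₁; proj₂)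
open import Data.Sum as Sum using (_⊎_; inj₁; inj₂; [_,_]′)
open import Data.Sum.Function.Propositional using (_⊎-cong_)
open import Function using (_∘_; id)
open import Function.Bundles using (_↔_; mk↔ₛ′; Equivalence)
open import Function.Properties.Inverse using (↔-sym; ↔-trans)
open import Relation.Binary.Definitions using (DecidableEquality)
open import Relation.Binary.PropositionalEquality
open import Relation.Binary.Construct.Closure.ReflexiveTransitive as Star using (Star; ε; _◅_; _◅◅_)
open import Relation.Binary.Construct.Closure.Transitive using ([_])
open import Relation.Nullary using (¬_; yes; no; contradiction)
open import Relation.Nullary.Decidable using (⌊_⌋; map′; isYes≗does; dec-true; dec-false; toWitness; fromWitness)

T↔Fin-ind : ∀ b → IsTrue b ↔ Fin (ind b)
T↔Fin-ind true  = ↔-sym 1↔⊤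
T↔Fin-ind false = ↔-sym 0↔⊥

Σ-Fin-suc↔ : ∀ {m} {P : Fin (suc m) → Set} → Σ (Fin (suc m)) P ↔ (P zero ⊎ Σ (Fin m) (P ∘ suc))
Σ-Fin-suc↔ {m} {P} = mk↔ₛ′ to from to-from from-to
  where
  to : Σ (Fin (suc m)) P → P zero ⊎ Σ (Fin m) (P ∘ suc)
  to (zero  , px) = inj₁ px
  to (suc x , px) = inj₂ (x , px)
  from : P zero ⊎ Σ (Fin m) (P ∘ suc) → Σ (Fin (suc m)) P
  from (inj₁ px)       = zero , px
  from (inj₂ (x , px)) = suc x , px
  to-from : ∀ y → to (from y) ≡ y
  to-from (inj₁ _) = refl
  to-from (inj₂ _) = refl
  from-to : ∀ x → from (to x) ≡ x
  from-to (zero  , _) = refl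
  from-to (suc _ , _) = refl

subset-isFinite : ∀ {m} (f : Fin m → Bool) → IsFinite (Σ (Fin m) (IsTrue ∘ f))
subset-isFinite {zero}  f = 0 , mk↔ₛ′ (λ { (() , _) }) (λ ()) (λ ()) (λ { (() , _) })
subset-isFinite {suc m} f with subset-isFinite (f ∘ suc)
... | c , tail↔ = ind (f zero) + c , ↔-trans Σ-Fin-suc↔ (↔-trans (T↔Fin-ind (f zero) ⊎-cong tail↔) (↔-sym +↔⊎))

proj₁-injective : ∀ {X : Set} {B : X → Bool} {x y : Σ X (IsTrue ∘ B)} → proj₁ x ≡ proj₁ y → x ≡ y
proj₁-injective {x = x , _} refl = cong (x ,_) (T-irrelevant _ _)

ind-≤ : ∀ {b m} → (b ≡ true → 1 ≤ m) → ind b ≤ m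
ind-≤ {false} _       = z≤n
ind-≤ {true}  present = present refl

module _ {A P T : Set} (N : Net A P T) where

  fire : Marking P → T → Marking P
  fire M t p = M p ∸ ind (pre N p t) + ind (post N t p)

  fire-fires : ∀ {M t} → Enabled N M t → Fires N M t (fire M t)
  fire-fires {M} {t} en = en , λ p → let b = ind (pre N p t) ; c = ind (post N t p) in begin
    M p ∸ b + c + b  ≡⟨ cong (_+ b) (+-∸-comm c (ind-≤ (en p))) ⟨
    M p + c ∸ b + b  ≡⟨ m∸n+n≡m (≤-trans (ind-≤ (en p)) (m≤m+n (M p) c)) ⟩
    M p + c          ∎
    where open ≡-Reasoning

  fires⇒≗fire : ∀ {M t M′} → Fires N M t M′ → M′ ≗ fire M t
  fires⇒≗fire {M} {t} {M′} (en , count) p = let b = ind (pre N p t) ; c = ind (post N t p) in begin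
    M′ p          ≡⟨ m+n∸n≡m (M′ p) b ⟨
    M′ p + b ∸ b  ≡⟨ cong (_∸ b) (count p) ⟩
    M p + c ∸ b   ≡⟨ +-∸-comm c (ind-≤ (en p)) ⟩
    M p ∸ b + c   ∎
    where open ≡-Reasoning

  fires-unproduced-≤ : ∀ {M t M′ p} → Fires N M t M′ → post N t p ≡ false → M′ p ≤ M p
  fires-unproduced-≤ {M} {t} {M′} {p} (_ , count) unproduced = begin
    M′ p                        ≤⟨ m≤m+n (M′ p) _ ⟩
    M′ p + ind (pre N p t)      ≡⟨ count p ⟩
    M p + ind (post N t p)      ≡⟨ cong (λ b → M p + ind b) unproduced ⟩
    M p + 0                     ≡⟨ +-identityʳ (M p) ⟩
    M p                         ∎
    where open ≤-Reasoning

  fires-consumes : ∀ {M t M′ p} → Fires N M t M′ → pre N p t ≡ true → post N t p ≡ false → M′ p + 1 ≡ M p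
  fires-consumes {M} {t} {M′} {p} (_ , count) consumed unproduced = begin
    M′ p + 1                    ≡⟨ cong (λ b → M′ p + ind b) consumed ⟨
    M′ p + ind (pre N p t)      ≡⟨ count p ⟩
    M p + ind (post N t p)      ≡⟨ cong (λ b → M p + ind b) unproduced ⟩
    M p + 0                     ≡⟨ +-identityʳ (M p) ⟩
    M p                         ∎
    where open ≡-Reasoning

  isSingleton-marked : ∀ {x M p} → IsSingleton N x M → 1 ≤ M p → ¬ p ≢ x
  isSingleton-marked (_ , zeros) marked p≢x = contradiction (subst (1 ≤_) (zeros _ p≢x) marked) λ ()

  isSingleton-unique : DecidableEquality P → ∀ {x M M′} → IsSingleton N x M → IsSingleton N x M′ → M ≗ M′
  isSingleton-unique _≟ᴾ_ {x} (one , zeros) (one′ , zeros′) p with p ≟ᴾ x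
  ... | yes refl = trans one (sym one′)
  ... | no p≢x   = trans (zeros p p≢x) (sym (zeros′ p p≢x))

  has-input : ∀ {i o} → IsWFNet N i o → ∀ t → ∃ λ p → pre N p t ≡ true
  has-input wf t = [ (λ ()) , id ]′ (start-or-input (proj₁ (IsWFNet.onPath wf (inj₂ t))))
    where
    start-or-input : ∀ {x} → Star (Arc N) x (inj₂ t) → x ≡ inj₂ t ⊎ ∃ λ p → pre N p t ≡ true
    start-or-input ε = inj₁ refl
    start-or-input (a ◅ σ) with start-or-input σ
    ... | inj₂ input = inj₂ input
    start-or-input {inj₁ p} (a ◅ σ) | inj₁ refl = inj₂ (p , a)
    start-or-input {inj₂ _} (() ◅ σ) | inj₁ refl

[_]ᴹ : ∀ {np} → Fin np → Marking (Fin np)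
[ x ]ᴹ p = ind ⌊ p ≟ x ⌋

[]ᴹ-isSingleton : ∀ {A np T} (N : Net A (Fin np) T) (x : Fin np) → IsSingleton N x [ x ]ᴹ
[]ᴹ-isSingleton N x =
  cong ind (trans (isYes≗does (x ≟ x)) (dec-true (x ≟ x) refl)) ,
  λ q q≢x → cong ind (trans (isYes≗does (q ≟ x)) (dec-false (q ≟ x) q≢x))

module Parts {A P T J : Set} (N : Net A P T) (g : T → J) where

  HasProducerIn : J → P → Set
  HasProducerIn j p = ∃ λ t → g t ≡ j × post N t p ≡ true

  HasConsumerIn : J → P → Set
  HasConsumerIn j p = ∃ λ t → g t ≡ j × pre N p t ≡ true

  TokensProducedIn : J → Marking P → Set
  TokensProducedIn j M = ∀ p → 1 ≤ M p → HasProducerIn j p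

  PartStep : J → Marking P → Marking P → Set
  PartStep j M M′ = ∃ λ t → g t ≡ j × Fires N M t M′

  partRun⇒run : ∀ {j M M′} → Star (PartStep j) M M′ → Star (Step N) M M′
  partRun⇒run = Star.map λ (t , _ , fr) → t , fr

  module Closed
    (same-part : ∀ {t p t′} → post N t p ≡ true → pre N p t′ ≡ true → g t ≡ g t′)
    (has-input : ∀ t → ∃ λ p → pre N p t ≡ true)
    where

    enabled-in-part : ∀ {j M t} → TokensProducedIn j M → Enabled N M t → g t ≡ j
    enabled-in-part {t = t} tokens en =
      let q , q→t = has-input t
          t′ , t′∈j , t′→q = tokens q (en q q→t)
      in trans (sym (same-part t′→q q→t)) t′∈j

    fires-tokensProducedIn : ∀ {j M t M′} → TokensProducedIn j M → Fires N M t M′ → g t ≡ j →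
                             TokensProducedIn j M′
    fires-tokensProducedIn {t = t} tokens fr t∈j p marked with post N t p in produced
    ... | true  = t , t∈j , produced
    ... | false = tokens p (≤-trans marked (fires-unproduced-≤ N fr produced))

    run-in-part : ∀ {j M M′} → TokensProducedIn j M → Star (Step N) M M′ →
                  Star (PartStep j) M M′ × TokensProducedIn j M′
    run-in-part tokens ε = ε , tokens
    run-in-part tokens ((t , fr) ◅ σ) =
      let t∈j = enabled-in-part tokens (proj₁ fr)
          σ′ , tokens′ = run-in-part (fires-tokensProducedIn tokens fr t∈j) σ
      in (t , t∈j , fr) ◅ σ′ , tokens′

    -- t consumes the only token (its input place must be the marked one), so every token left was produced by t.
    first-step-in-part : ∀ {i M₀ t M₁ j} → IsSingleton N i M₀ → Fires N M₀ t M₁ → g t ≡ j →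
                         TokensProducedIn j M₁
    first-step-in-part {t = t} s fr t∈j p marked with post N t p in produced
    ... | true  = t , t∈j , produced
    ... | false =
      let q , q→t = has-input t in
      ⊥-elim (isSingleton-marked N s (≤-trans marked (fires-unproduced-≤ N fr produced)) λ { refl →
              isSingleton-marked N s (proj₁ fr q q→t) λ { refl →
              <⇒≢ (m<n+m 1 marked) (sym (trans (fires-consumes N fr q→t produced) (proj₁ s))) } })

    initial-run-in-part : ∀ {i M₀ M t j} → IsSingleton N i M₀ → Star (Step N) M₀ M → Enabled N M t → g t ≡ j →
                          Star (PartStep j) M₀ M × (∀ {M′} → Fires N M t M′ → TokensProducedIn j M′)
    initial-run-in-part s ε en t∈j = ε , λ fr → first-step-in-part s fr t∈j
    initial-run-in-part {j = j} s ((t₁ , fr₁) ◅ σ) en t∈j =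
      let σ′ , tokens = run-in-part (first-step-in-part s fr₁ t₁∈j) σ
      in (t₁ , t₁∈j , fr₁) ◅ σ′ , λ fr → fires-tokensProducedIn tokens fr t∈j
      where
      -- σ is first run in the part of t₁, whose tokens then show that t, hence t₁, lies in part j.
      t₁∈j : g t₁ ≡ j
      t₁∈j = trans (sym (enabled-in-part (proj₂ (run-in-part (first-step-in-part s fr₁ refl) σ)) en)) t∈j

module Restriction {A : Set} {np nt n : ℕ} (N : Net A (Fin np) (Fin nt)) (g : Fin nt → Fin n) (k : Fin n) where

  open Parts N g

  N′ : Net A (ProjP N g k) (ProjT N g k)
  N′ = xorproject N g k

  adjacent-in-part : Fin np → Fin nt → Bool
  adjacent-in-part p t = inPart N g k t ∧ (post N t p ∨ pre N p t)

  inProjPlaces-intro : ∀ {t p} → g t ≡ k → post N t p ≡ true ⊎ pre N p t ≡ true → IsTrue (inProjPlaces N g k p)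
  inProjPlaces-intro {t} {p} t∈k adjacent =
    any⁺ (adjacent-in-part p) (lose (∈-allFin t) (Equivalence.from T-∧
      (fromWitness t∈k , Equivalence.from T-∨ (Sum.map (Equivalence.from T-≡) (Equivalence.from T-≡) adjacent))))

  inProjPlaces-elim : ∀ {p} → IsTrue (inProjPlaces N g k p) → HasProducerIn k p ⊎ HasConsumerIn k p
  inProjPlaces-elim {p} inP =
    let t , inP′ = satisfied (any⁻ (adjacent-in-part p) (allFin nt) inP)
        t∈k , adjacent = Equivalence.to T-∧ inP′
    in Sum.map (λ t→p → t , toWitness t∈k , Equivalence.to T-≡ t→p)
               (λ p→t → t , toWitness t∈k , Equivalence.to T-≡ p→t)
               (Equivalence.to T-∨ adjacent)

  _≟ᴾ_ : DecidableEquality (ProjP N g k)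
  p′ ≟ᴾ q′ = map′ proj₁-injective (cong proj₁) (proj₁ p′ ≟ proj₁ q′)

  restrict-isSingleton : ∀ {x hx M m} → m ≗ M ∘ proj₁ → IsSingleton N x M → IsSingleton N′ (x , hx) m
  restrict-isSingleton m≗M (one , zeros) =
    trans (m≗M _) one , λ q′ q′≢x → trans (m≗M q′) (zeros _ (q′≢x ∘ proj₁-injective))

  partStep-restrict : ∀ {M M′ m} → m ≗ M ∘ proj₁ → PartStep k M M′ → Step N′ m (M′ ∘ proj₁)
  partStep-restrict m≗M (t , t∈k , en , count) =
    (t , fromWitness t∈k) ,
    (λ p′ p→t → subst (1 ≤_) (sym (m≗M p′)) (en _ p→t)) ,
    (λ p′ → trans (count _) (cong (_+ _) (sym (m≗M p′))))

  partRun-restrict : ∀ {M M′ m} → m ≗ M ∘ proj₁ → Star (PartStep k) M M′ →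
                     ∃ λ m′ → Star (Step N′) m m′ × m′ ≗ M′ ∘ proj₁
  partRun-restrict {m = m} m≗M ε = m , ε , m≗M
  partRun-restrict m≗M (s ◅ σ) =
    let m′ , σ′ , m′≗M′ = partRun-restrict (λ _ → refl) σ
    in m′ , partStep-restrict m≗M s ◅ σ′ , m′≗M′

  step-extend : ∀ {M m m′} → m ≗ M ∘ proj₁ → Step N′ m m′ → ∃ λ M′ → PartStep k M M′ × m′ ≗ M′ ∘ proj₁
  step-extend {M} {m} {m′} m≗M ((t , inT) , fr′@(en′ , _)) = fire N M t , (t , t∈k , fire-fires N en) , agree
    where
    t∈k : g t ≡ k
    t∈k = toWitness inT
    en : Enabled N M t
    en p p→t = subst (1 ≤_) (m≗M (p , inProjPlaces-intro t∈k (inj₂ p→t))) (en′ _ p→t)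
    agree : m′ ≗ fire N M t ∘ proj₁
    agree p′ = trans (fires⇒≗fire N′ {m} {t , inT} {m′} fr′ p′)
                     (cong (λ x → x ∸ ind (pre N (proj₁ p′) t) + ind (post N t (proj₁ p′))) (m≗M p′))

  run-extend : ∀ {M m m′} → m ≗ M ∘ proj₁ → Star (Step N′) m m′ →
               ∃ λ M′ → Star (PartStep k) M M′ × m′ ≗ M′ ∘ proj₁
  run-extend {M} m≗M ε = M , ε , m≗M
  run-extend m≗M (s ◅ σ) =
    let M₁ , s′ , m₁≗M₁ = step-extend m≗M s
        M′ , σ′ , m′≗M′ = run-extend m₁≗M₁ σ
    in M′ , s′ ◅ σ′ , m′≗M′

  reachable-extend : ∀ {i hi m} → ReachableFrom N′ (i , hi) m →
                     ∃ λ M → Star (PartStep k) [ i ]ᴹ M × m ≗ M ∘ proj₁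
  reachable-extend {i} (_ , s , σ) =
    run-extend (isSingleton-unique N′ _≟ᴾ_ s (restrict-isSingleton (λ _ → refl) ([]ᴹ-isSingleton N i))) σ

module Structure {A : Set} {np nt n : ℕ} (N : Net A (Fin np) (Fin nt)) (g : Fin nt → Fin n)
  (same-part : ∀ {t p t′} → post N t p ≡ true → pre N p t′ ≡ true → g t ≡ g t′) (k : Fin n) where

  open Parts N g
  open Restriction N g k

  ForwardIn : Node N → Set
  ForwardIn (inj₁ p) = HasProducerIn k p
  ForwardIn (inj₂ t) = g t ≡ k

  BackwardIn : Node N → Set
  BackwardIn (inj₁ p) = HasConsumerIn k p
  BackwardIn (inj₂ t) = g t ≡ k

  forwardIn-arc : ∀ {x y} → Arc N x y → ForwardIn x → ForwardIn y
  forwardIn-arc {inj₁ _} {inj₂ _} p→t (_ , t′∈k , t′→p) = trans (sym (same-part t′→p p→t)) t′∈k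
  forwardIn-arc {inj₂ t} {inj₁ _} t→p t∈k              = t , t∈k , t→p
  forwardIn-arc {inj₁ _} {inj₁ _} ()
  forwardIn-arc {inj₂ _} {inj₂ _} ()

  backwardIn-arc : ∀ {x y} → Arc N x y → BackwardIn y → BackwardIn x
  backwardIn-arc {inj₁ _} {inj₂ t} p→t t∈k              = t , t∈k , p→t
  backwardIn-arc {inj₂ _} {inj₁ _} t→p (_ , t′∈k , p→t′) = trans (same-part t→p p→t′) t′∈k
  backwardIn-arc {inj₁ _} {inj₁ _} ()
  backwardIn-arc {inj₂ _} {inj₂ _} ()

  forwardIn-path : ∀ {x y} → Star (Arc N) x y → ForwardIn x → ForwardIn y
  forwardIn-path ε       fx = fx
  forwardIn-path (a ◅ σ) fx = forwardIn-path σ (forwardIn-arc a fx)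

  backwardIn-path : ∀ {x y} → Star (Arc N) x y → BackwardIn y → BackwardIn x
  backwardIn-path ε       by = by
  backwardIn-path (a ◅ σ) by = backwardIn-arc a (backwardIn-path σ by)

  InProj : Node N → Set
  InProj (inj₁ p) = IsTrue (inProjPlaces N g k p)
  InProj (inj₂ t) = IsTrue (inPart N g k t)

  inProj-irrelevant : ∀ {x} (h h′ : InProj x) → h ≡ h′
  inProj-irrelevant {inj₁ _} = T-irrelevant
  inProj-irrelevant {inj₂ _} = T-irrelevant

  forwardIn⇒inProj : ∀ {x} → ForwardIn x → InProj x
  forwardIn⇒inProj {inj₁ _} (_ , t∈k , t→p) = inProjPlaces-intro t∈k (inj₁ t→p)
  forwardIn⇒inProj {inj₂ _} t∈k             = fromWitness t∈k

  backwardIn⇒inProj : ∀ {x} → BackwardIn x → InProj x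
  backwardIn⇒inProj {inj₁ _} (_ , t∈k , p→t) = inProjPlaces-intro t∈k (inj₂ p→t)
  backwardIn⇒inProj {inj₂ _} t∈k             = fromWitness t∈k

  restrictNode : (x : Node N) → InProj x → Node N′
  restrictNode (inj₁ p) hp = inj₁ (p , hp)
  restrictNode (inj₂ t) ht = inj₂ (t , ht)

  restrict-arc : ∀ x y {hx hy} → Arc N x y → Arc N′ (restrictNode x hx) (restrictNode y hy)
  restrict-arc (inj₁ _) (inj₂ _) a = a
  restrict-arc (inj₂ _) (inj₁ _) a = a
  restrict-arc (inj₁ _) (inj₁ _) ()
  restrict-arc (inj₂ _) (inj₂ _) ()

  restrict-ε : ∀ {x} (hx hx′ : InProj x) → Star (Arc N′) (restrictNode x hx) (restrictNode x hx′)
  restrict-ε {x} hx hx′ = subst (Star (Arc N′) _) (cong (restrictNode x) (inProj-irrelevant {x} hx hx′)) ε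

  restrict-forward : ∀ {x y} → ForwardIn x → (hx : InProj x) (hy : InProj y) → Star (Arc N) x y →
                     Star (Arc N′) (restrictNode x hx) (restrictNode y hy)
  restrict-forward fx hx hy ε = restrict-ε hx hy
  restrict-forward {x} fx hx hy (_◅_ {j = z} a σ) =
    restrict-arc x z a ◅ restrict-forward fz (forwardIn⇒inProj fz) hy σ
    where
    fz : ForwardIn z
    fz = forwardIn-arc a fx

  restrict-backward : ∀ {x y} → BackwardIn y → (hx : InProj x) (hy : InProj y) → Star (Arc N) x y →
                      Star (Arc N′) (restrictNode x hx) (restrictNode y hy)
  restrict-backward by hx hy ε = restrict-ε hx hy
  restrict-backward {x} by hx hy (_◅_ {j = z} a σ) =
    restrict-arc x z a ◅ restrict-backward by (backwardIn⇒inProj (backwardIn-path σ by)) hy σ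

  unproduced-extend : ∀ {p} (hp : IsTrue (inProjPlaces N g k p)) →
                      (∀ t′ → post N′ t′ (p , hp) ≡ false) → ∀ t → post N t p ≡ false
  unproduced-extend {p} hp unproduced t with post N t p in produced
  ... | false = refl
  ... | true with inProjPlaces-elim hp
  ...   | inj₁ (t′ , t′∈k , t′→p) = trans (sym t′→p) (unproduced (t′ , fromWitness t′∈k))
  ...   | inj₂ (t′ , t′∈k , p→t′) =
          trans (sym produced) (unproduced (t , fromWitness (trans (same-part produced p→t′) t′∈k)))

  unconsumed-extend : ∀ {p} (hp : IsTrue (inProjPlaces N g k p)) →
                      (∀ t′ → pre N′ (p , hp) t′ ≡ false) → ∀ t → pre N p t ≡ false
  unconsumed-extend {p} hp unconsumed t with pre N p t in consumed
  ... | false = refl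
  ... | true with inProjPlaces-elim hp
  ...   | inj₂ (t′ , t′∈k , p→t′) = trans (sym p→t′) (unconsumed (t′ , fromWitness t′∈k))
  ...   | inj₁ (t′ , t′∈k , t′→p) =
          trans (sym consumed) (unconsumed (t , fromWitness (trans (sym (same-part t′→p consumed)) t′∈k)))

  module _ {i o} (wf : IsWFNet N i o) where

    open IsWFNet wf

    source-inProj : ∀ {t} → g t ≡ k → IsTrue (inProjPlaces N g k i)
    source-inProj {t} t∈k = backwardIn⇒inProj (backwardIn-path (proj₁ (onPath (inj₂ t))) t∈k)

    sink-inProj : ∀ {t} → g t ≡ k → IsTrue (inProjPlaces N g k o)
    sink-inProj {t} t∈k = forwardIn⇒inProj (forwardIn-path (proj₂ (onPath (inj₂ t))) t∈k)

    xorproject-isWFNet : (hi : IsTrue (inProjPlaces N g k i)) (ho : IsTrue (inProjPlaces N g k o)) →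
                         IsWFNet N′ (i , hi) (o , ho)
    xorproject-isWFNet hi ho = record
      { source = λ (p , hp) →
          (λ unproduced → proj₁-injective (proj₁ (source p) (unproduced-extend hp unproduced))) ,
          λ { refl t′ → proj₂ (source i) refl (proj₁ t′) }
      ; sink = λ (p , hp) →
          (λ unconsumed → proj₁-injective (proj₁ (sink p) (unconsumed-extend hp unconsumed))) ,
          λ { refl t′ → proj₂ (sink o) refl (proj₁ t′) }
      ; onPath = onPath′
      }
      where
      from-source : ∀ {x} → BackwardIn x → (hx : InProj x) → Star (Arc N′) (inj₁ (i , hi)) (restrictNode x hx)
      from-source {x} bx hx = restrict-backward bx hi hx (proj₁ (onPath x))

      to-sink : ∀ {x} → ForwardIn x → (hx : InProj x) → Star (Arc N′) (restrictNode x hx) (inj₁ (o , ho))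
      to-sink {x} fx hx = restrict-forward fx hx ho (proj₂ (onPath x))

      onPath′ : ∀ x → Star (Arc N′) (inj₁ (i , hi)) x × Star (Arc N′) x (inj₁ (o , ho))
      onPath′ (inj₂ (t , ht)) = from-source {inj₂ t} (toWitness ht) ht , to-sink {inj₂ t} (toWitness ht) ht
      onPath′ (inj₁ (p , hp)) with inProjPlaces-elim hp
      ... | inj₁ produced@(t , t∈k , t→p) =
            from-source {inj₂ t} t∈k (fromWitness t∈k) ◅◅ t→p ◅ ε , to-sink {inj₁ p} produced hp
      ... | inj₂ consumed@(t , t∈k , p→t) =
            from-source {inj₁ p} consumed hp , p→t ◅ to-sink {inj₂ t} t∈k (fromWitness t∈k)

module Behaviour {A : Set} {np nt n : ℕ} (N : Net A (Fin np) (Fin nt)) (g : Fin nt → Fin n)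
  (same-part : ∀ {t p t′} → post N t p ≡ true → pre N p t′ ≡ true → g t ≡ g t′)
  {i o : Fin np} (wf : IsWFNet N i o) (safe : IsSafe N i) (sound : IsSound N i o)
  {k : Fin n} (part-nonempty : ∃ λ t → g t ≡ k) where

  open Parts N g
  open Parts.Closed N g same-part (has-input N wf)
  open Restriction N g k
  open Structure N g same-part k
  open IsSound sound

  i′ : ProjP N g k
  i′ = i , source-inProj wf (proj₂ part-nonempty)

  o′ : ProjP N g k
  o′ = o , sink-inProj wf (proj₂ part-nonempty)

  partRun-reachable : ∀ {M} → Star (PartStep k) [ i ]ᴹ M → ReachableFrom N i M
  partRun-reachable σ = [ i ]ᴹ , []ᴹ-isSingleton N i , partRun⇒run σ

  -- From [i] any part may be entered, so a run of part k is found by making some t₀ ∈ T_k fire;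
  -- quasi-liveness provides the initial marking of that run only up to ≗.
  initial-completes : ∃₂ λ M₀ Mf → [ i ]ᴹ ≗ M₀ × Star (PartStep k) M₀ Mf × IsSingleton N o Mf
  initial-completes =
    let t₀ , t₀∈k = part-nonempty
        M , (M₀ , s , σ) , en = quasiLive t₀
        σ′ , tokens = initial-run-in-part s σ en t₀∈k
        fr = fire-fires N en
        Mf , τ , final = canFinish (fire N M t₀) (M₀ , s , σ ◅◅ (t₀ , fr) ◅ ε)
    in M₀ , Mf , isSingleton-unique N _≟_ ([]ᴹ-isSingleton N i) s ,
       σ′ ◅◅ (t₀ , t₀∈k , fr) ◅ proj₁ (run-in-part (tokens fr) τ) , final

  partRun-completes : ∀ {M} → Star (PartStep k) [ i ]ᴹ M →
                      ∃₂ λ M₁ Mf → M ≗ M₁ × Star (PartStep k) M₁ Mf × IsSingleton N o Mf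
  partRun-completes ε = initial-completes
  partRun-completes {M} σ@((_ , t∈k , fr) ◅ σ₁) =
    let tokens = proj₂ (run-in-part (first-step-in-part ([]ᴹ-isSingleton N i) fr t∈k) (partRun⇒run σ₁))
        Mf , τ , final = canFinish M (partRun-reachable σ)
    in M , Mf , (λ _ → refl) , proj₁ (run-in-part tokens τ) , final

  safe′ : IsSafe N′ i′
  safe′ m reachable p′ =
    let M , σ , m≗M = reachable-extend reachable
    in subst (_≤ 1) (sym (m≗M p′)) (safe M (partRun-reachable σ) (proj₁ p′))

  sound′ : IsSound N′ i′ o′
  sound′ = record
    { quasiLive = λ (t , inT) →
        let M , (M₀ , s , σ) , en = quasiLive t
            m , σ′ , m≗M = partRun-restrict (λ _ → refl) (proj₁ (initial-run-in-part s σ en (toWitness inT)))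
        in m , (M₀ ∘ proj₁ , restrict-isSingleton (λ _ → refl) s , σ′) ,
           λ p′ p→t → subst (1 ≤_) (sym (m≗M p′)) (en _ p→t)
    ; canFinish = λ m reachable →
        let M , σ , m≗M = reachable-extend reachable
            M₁ , Mf , M≗M₁ , τ , final = partRun-completes σ
            m′ , τ′ , m′≗Mf = partRun-restrict (λ p′ → trans (m≗M p′) (M≗M₁ (proj₁ p′))) τ
        in m′ , τ′ , restrict-isSingleton m′≗Mf final
    ; properEnd = λ m reachable marked →
        let M , σ , m≗M = reachable-extend reachable
        in restrict-isSingleton m≗M (properEnd M (partRun-reachable σ) (subst (1 ≤_) (m≗M o′) marked))
    }

lemma1 : {A : Set} {np nt n : ℕ} (N : Net A (Fin np) (Fin nt)) (g : Fin nt → Fin n) →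
    IsXORPattern N g →
    (k : Fin n) →
      IsPetriNet (xorproject N g k) × SafeSoundWFNet (xorproject N g k)
lemma1 N g ((i , o , wf , safe , sound) , _ , surjective , xor) k =
  (subset-isFinite _ , subset-isFinite _) ,
  (i′ , o′ , xorproject-isWFNet wf (proj₂ i′) (proj₂ o′) , safe′ , sound′)
  where
  same-part : ∀ {t p t′} → post N t p ≡ true → pre N p t′ ≡ true → g t ≡ g t′
  same-part t→p p→t′ = xor _ _ [ _ , t→p , p→t′ ]
  open Structure N g same-part k
  open Behaviour N g same-part wf safe sound (surjective k)
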